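{- For all integers $m$ and $n$, \[ \sum_{k = 1}^n (-1)^{k - 1} F_{mk}^{\,4} = \frac{F_{mn} F_{mn + m} \left\{ (-1)^{n-1}L_m L_{mn} L_{mn + m} + (-1)^{n(m-1)}4L_{2m} \right\}}{5L_m L_{2m}} . \]
   Context: $F_n$ and $L_n$ ($n\in\mathbb{Z}$) are the Fibonacci and Lucas numbers: $F_n=F_{n-1}+F_{n-2}$ with $F_0=0$, $F_1=1$; $L_n=L_{n-1}+L_{n-2}$ with $L_0=2$, $L_1=1$; extended to negative indices by $F_{ -n}=(-1)^{n-1}F_n$, $L_{ -n}=(-1)^nL_n$. For $n=0$ the sum $\sum_{k=1}^n$ is empty. For $n<0$ the sum follows the convention $\sum_{k=1}^n a_k=-\sum_{k=n+1}^{0}a_k$. -}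

module Defs where

open import Data.Nat as ℕ using (ℕ; zero; suc)
open import Data.Integer using (ℤ; +_; -[1+_]; _+_; _*_; -_; _-_; ∣_∣)

fibℕ : ℕ → ℕ
fibℕ zero = 0
fibℕ (suc zero) = 1
fibℕ (suc (suc n)) = fibℕ (suc n) ℕ.+ fibℕ n

lucℕ : ℕ → ℕ
lucℕ zero = 2
lucℕ (suc zero) = 1
lucℕ (suc (suc n)) = lucℕ (suc n) ℕ.+ lucℕ n

sgnℕ : ℕ → ℤ
sgnℕ zero = + 1
sgnℕ (suc n) = - sgnℕ n

neg1^ : ℤ → ℤ
neg1^ z = sgnℕ ∣ z ∣

-- Extension to ℤ:  F_{-n} = (-1)^{n-1} F_n,  L_{-n} = (-1)^n L_n
F : ℤ → ℤ
F (+ n) = + fibℕ n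
F -[1+ n ] = sgnℕ n * + fibℕ (suc n)

L : ℤ → ℤ
L (+ n) = + lucℕ n
L -[1+ n ] = sgnℕ (suc n) * + lucℕ (suc n)

sumFrom1 : (ℤ → ℤ) → ℕ → ℤ
sumFrom1 a zero = + 0
sumFrom1 a (suc n) = sumFrom1 a n + a (+ suc n)

sumNeg : (ℤ → ℤ) → ℕ → ℤ
sumNeg a zero = a (+ 0)
sumNeg a (suc n) = sumNeg a n + a -[1+ n ]

-- Σ_{k=1}^{n} a k for integer n, with the convention
-- Σ_{k=1}^{n} a_k = - Σ_{k=n+1}^{0} a_k  for n < 0.
-- For n = -[1+ m ] = -(m+1), the range k = -m .. 0 is k = -j, j = 0..m.
Sum : (ℤ → ℤ) → ℤ → ℤ
Sum a (+ n) = sumFrom1 a n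
Sum a -[1+ m ] = - sumNeg a m

{-# OPTIONS --safe #-}
-- Both sides vanish at n = 0 and the ℤ-indexed sum satisfies Sum a n − Sum a (n − 1) = a n for every
-- integer n, so it suffices that the right-hand side has the same differences. With N = mn these reduce,
-- by the identities
--   F(N+m) + (−1)^m F(N−m) = F_N L_m,   F(N+m) L(N+m) + F(N−m) L(N−m) = F_N L_N L_{2m},   L_N² − 5F_N² = 4(−1)^N,
-- to 5 L_m L_{2m} (−1)^(n−1) F_N⁴. All three come from the addition formulas
-- 2F(a+b) = F_a L_b + L_a F_b and 2L(a+b) = L_a L_b + 5F_a F_b, which hold because both sides satisfy the
-- Fibonacci recurrence in a and agree at a = 0, 1.
module Submission where

open import Defs
open import Data.Nat as ℕ using (ℕ; zero; suc)
import Data.Nat.Properties as ℕP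
open import Data.Integer using (ℤ; +_; -[1+_]; _+_; _*_; _-_; -_; _^_; ∣_∣)
import Data.Integer.Properties as ℤP
open import Data.Integer.Tactic.RingSolver using (solve; solve-∀)
open import Data.List using (_∷_; [])
open import Data.Product using (_×_; _,_; proj₁)
open import Relation.Binary.PropositionalEquality
open import Algebra.Properties.CommutativeSemigroup ℤP.+-commutativeSemigroup using () renaming (interchange to +-interchange)
open import Algebra.Properties.AbelianGroup ℤP.+-0-abelianGroup using () renaming (∙-cancelˡ to +-cancelˡ)
open import Algebra.Properties.Ring ℤP.+-*-ring using (x[y-z]≈xy-xz)
open ≡-Reasoning

ℤ-induction : (P : ℤ → Set) → P (+ 0) →
              (∀ z → P z → P (z + + 1)) → (∀ z → P (z + + 1) → P z) → ∀ z → P z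
ℤ-induction P base up down (+ zero) = base
ℤ-induction P base up down (+ suc k) =
  subst P (cong +_ (ℕP.+-comm k 1)) (up (+ k) (ℤ-induction P base up down (+ k)))
ℤ-induction P base up down -[1+ zero ] = down -[1+ zero ] base
ℤ-induction P base up down -[1+ suc k ] =
  down -[1+ suc k ] (ℤ-induction P base up down -[1+ k ])

sgnℕ-square : ∀ k → sgnℕ k * sgnℕ k ≡ + 1
sgnℕ-square zero = refl
sgnℕ-square (suc k) = trans (neg*neg (sgnℕ k) (sgnℕ k)) (sgnℕ-square k)
  where
  neg*neg : ∀ x y → - x * - y ≡ x * y
  neg*neg = solve-∀

neg1^-square : ∀ z → neg1^ z * neg1^ z ≡ + 1
neg1^-square z = sgnℕ-square ∣ z ∣

neg1^-cancel : ∀ z x → neg1^ z * (neg1^ z * x) ≡ x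
neg1^-cancel z x = begin
  neg1^ z * (neg1^ z * x) ≡⟨ ℤP.*-assoc (neg1^ z) (neg1^ z) x ⟨
  neg1^ z * neg1^ z * x   ≡⟨ cong (_* x) (neg1^-square z) ⟩
  + 1 * x                 ≡⟨ ℤP.*-identityˡ x ⟩
  x                       ∎

neg1^-suc : ∀ z → neg1^ (z + + 1) ≡ - neg1^ z
neg1^-suc (+ k) = cong sgnℕ (ℕP.+-comm k 1)
neg1^-suc -[1+ zero ] = refl
neg1^-suc -[1+ suc k ] = sym (ℤP.neg-involutive (sgnℕ (suc k)))

neg1^-neg : ∀ z → neg1^ (- z) ≡ neg1^ z
neg1^-neg z = cong sgnℕ (ℤP.∣-i∣≡∣i∣ z)

neg1^-+ : ∀ a b → neg1^ (a + b) ≡ neg1^ a * neg1^ b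
neg1^-+ a = ℤ-induction (λ b → neg1^ (a + b) ≡ neg1^ a * neg1^ b) base up down
  where
  base : neg1^ (a + + 0) ≡ neg1^ a * + 1
  base = trans (cong neg1^ (ℤP.+-identityʳ a)) (sym (ℤP.*-identityʳ (neg1^ a)))
  flip : ∀ b → neg1^ (a + (b + + 1)) ≡ - neg1^ (a + b)
  flip b = trans (cong neg1^ (sym (ℤP.+-assoc a b (+ 1)))) (neg1^-suc (a + b))
  flip′ : ∀ b → neg1^ a * neg1^ (b + + 1) ≡ - (neg1^ a * neg1^ b)
  flip′ b = trans (cong (neg1^ a *_) (neg1^-suc b)) (sym (ℤP.neg-distribʳ-* (neg1^ a) (neg1^ b)))
  up : ∀ b → neg1^ (a + b) ≡ neg1^ a * neg1^ b →
       neg1^ (a + (b + + 1)) ≡ neg1^ a * neg1^ (b + + 1)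
  up b ih = trans (flip b) (trans (cong -_ ih) (sym (flip′ b)))
  down : ∀ b → neg1^ (a + (b + + 1)) ≡ neg1^ a * neg1^ (b + + 1) →
         neg1^ (a + b) ≡ neg1^ a * neg1^ b
  down b ih = ℤP.neg-injective (trans (sym (flip b)) (trans ih (flip′ b)))

neg1^-pred : ∀ z → neg1^ (z - + 1) ≡ - neg1^ z
neg1^-pred z = begin
  neg1^ (z - + 1)       ≡⟨ neg1^-+ z (- + 1) ⟩
  neg1^ z * - + 1       ≡⟨ ℤP.*-comm (neg1^ z) (- + 1) ⟩
  - + 1 * neg1^ z       ≡⟨ ℤP.-1*i≡-i (neg1^ z) ⟩
  - neg1^ z             ∎

neg1^-sub : ∀ a b → neg1^ (a - b) ≡ neg1^ a * neg1^ b
neg1^-sub a b = trans (neg1^-+ a (- b)) (cong (neg1^ a *_) (neg1^-neg b))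

record FibRecurrence (f : ℤ → ℤ) : Set where
  constructor fibRecurrence
  field
    step : ∀ z → f (z + + 2) ≡ f (z + + 1) + f z

open FibRecurrence

FibRecurrence-shift : ∀ {f} → FibRecurrence f → ∀ d → FibRecurrence (λ z → f (z + d))
FibRecurrence-shift {f} rec d = fibRecurrence λ z → begin
  f (z + + 2 + d)             ≡⟨ cong f (shift-2 z d) ⟩
  f (z + d + + 2)             ≡⟨ step rec (z + d) ⟩
  f (z + d + + 1) + f (z + d) ≡⟨ cong (λ w → f w + f (z + d)) (shift-1 z d) ⟨
  f (z + + 1 + d) + f (z + d) ∎
  where
  shift-2 : ∀ z d → z + + 2 + d ≡ z + d + + 2
  shift-2 = solve-∀
  shift-1 : ∀ z d → z + + 1 + d ≡ z + d + + 1
  shift-1 = solve-∀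

FibRecurrence-scaleˡ : ∀ {f} → FibRecurrence f → ∀ c → FibRecurrence (λ z → c * f z)
FibRecurrence-scaleˡ {f} rec c = fibRecurrence λ z →
  trans (cong (c *_) (step rec z)) (ℤP.*-distribˡ-+ c (f (z + + 1)) (f z))

FibRecurrence-scaleʳ : ∀ {f} → FibRecurrence f → ∀ c → FibRecurrence (λ z → f z * c)
FibRecurrence-scaleʳ {f} rec c = fibRecurrence λ z →
  trans (cong (_* c) (step rec z)) (ℤP.*-distribʳ-+ c (f (z + + 1)) (f z))

FibRecurrence-+ : ∀ {f g} → FibRecurrence f → FibRecurrence g → FibRecurrence (λ z → f z + g z)
FibRecurrence-+ {f} {g} recf recg = fibRecurrence λ z →
  trans (cong₂ _+_ (step recf z) (step recg z)) (+-interchange (f (z + + 1)) (f z) (g (z + + 1)) (g z))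

FibRecurrence-unique : ∀ {f g} → FibRecurrence f → FibRecurrence g →
                       f (+ 0) ≡ g (+ 0) → f (+ 1) ≡ g (+ 1) → ∀ z → f z ≡ g z
FibRecurrence-unique {f} {g} recf recg eq₀ eq₁ z =
  proj₁ (ℤ-induction Agree (eq₀ , eq₁) up down z)
  where
  Agree : ℤ → Set
  Agree z = f z ≡ g z × f (z + + 1) ≡ g (z + + 1)
  two : ∀ z → z + + 1 + + 1 ≡ z + + 2
  two = solve-∀
  next : ∀ {h} → FibRecurrence h → ∀ z → h (z + + 1 + + 1) ≡ h (z + + 1) + h z
  next {h} rec z = trans (cong h (two z)) (step rec z)
  up : ∀ z → Agree z → Agree (z + + 1)
  up z (e , e′) = e′ , trans (next recf z) (trans (cong₂ _+_ e′ e) (sym (next recg z)))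
  down : ∀ z → Agree (z + + 1) → Agree z
  down z (e′ , e″) = +-cancelˡ (f (z + + 1)) (f z) (g z) sums , e′
    where
    sums : f (z + + 1) + f z ≡ f (z + + 1) + g z
    sums = trans (sym (next recf z)) (trans e″ (trans (next recg z) (cong (_+ g z) (sym e′))))

-- The recurrence at index -(k + 3) for a sequence that equals ± u on negative indices with alternating signs.
alternating-rec : ∀ s (u : ℕ → ℕ) k → u (suc (suc (suc k))) ≡ u (suc (suc k)) ℕ.+ u (suc k) →
                  s * + u (suc k) ≡ - s * + u (suc (suc k)) + - - s * + u (suc (suc (suc k)))
alternating-rec s u k rec = begin
  s * y                       ≡⟨ alternate s y x ⟩
  - s * x + - - s * (x + y)   ≡⟨ cong (λ w → - s * x + - - s * w) (sym (trans (cong +_ rec) (ℤP.pos-+ _ (u (suc k))))) ⟩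
  - s * x + - - s * + u (suc (suc (suc k))) ∎
  where
  x y : ℤ
  x = + u (suc (suc k))
  y = + u (suc k)
  alternate : ∀ s y x → s * y ≡ - s * x + - - s * (x + y)
  alternate = solve-∀

pos-rec : ∀ (u : ℕ → ℕ) → (∀ k → u (suc (suc k)) ≡ u (suc k) ℕ.+ u k) →
          ∀ k → + u (k ℕ.+ 2) ≡ + u (k ℕ.+ 1) + + u k
pos-rec u rec k = begin
  + u (k ℕ.+ 2)             ≡⟨ cong (λ i → + u i) (ℕP.+-comm k 2) ⟩
  + u (suc (suc k))         ≡⟨ cong +_ (rec k) ⟩
  + (u (suc k) ℕ.+ u k)     ≡⟨ ℤP.pos-+ (u (suc k)) (u k) ⟩
  + u (suc k) + + u k       ≡⟨ cong (λ i → + u i + + u k) (ℕP.+-comm 1 k) ⟩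
  + u (k ℕ.+ 1) + + u k     ∎

F-rec : FibRecurrence F
F-rec = fibRecurrence F-step
  where
  F-step : ∀ z → F (z + + 2) ≡ F (z + + 1) + F z
  F-step (+ k) = pos-rec fibℕ (λ _ → refl) k
  F-step -[1+ zero ] = refl
  F-step -[1+ suc zero ] = refl
  F-step -[1+ suc (suc k) ] = alternating-rec (sgnℕ k) fibℕ k refl

L-rec : FibRecurrence L
L-rec = fibRecurrence L-step
  where
  L-step : ∀ z → L (z + + 2) ≡ L (z + + 1) + L z
  L-step (+ k) = pos-rec lucℕ (λ _ → refl) k
  L-step -[1+ zero ] = refl
  L-step -[1+ suc zero ] = refl
  L-step -[1+ suc (suc k) ] = alternating-rec (sgnℕ (suc k)) lucℕ k refl

F-suc : ∀ b → + 2 * F (b + + 1) ≡ F b + L b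
F-suc = FibRecurrence-unique
  (FibRecurrence-scaleˡ (FibRecurrence-shift F-rec (+ 1)) (+ 2)) (FibRecurrence-+ F-rec L-rec) refl refl

L-suc : ∀ b → + 2 * L (b + + 1) ≡ L b + + 5 * F b
L-suc = FibRecurrence-unique
  (FibRecurrence-scaleˡ (FibRecurrence-shift L-rec (+ 1)) (+ 2))
  (FibRecurrence-+ L-rec (FibRecurrence-scaleˡ F-rec (+ 5))) refl refl

F-add : ∀ a b → + 2 * F (a + b) ≡ F a * L b + L a * F b
F-add a b = FibRecurrence-unique
  (FibRecurrence-scaleˡ (FibRecurrence-shift F-rec b) (+ 2))
  (FibRecurrence-+ (FibRecurrence-scaleʳ F-rec (L b)) (FibRecurrence-scaleʳ L-rec (F b)))
  (trans (cong (λ i → + 2 * F i) (ℤP.+-identityˡ b)) (at-0 (F b) (L b)))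
  (trans (cong (λ i → + 2 * F i) (ℤP.+-comm (+ 1) b)) (trans (F-suc b) (at-1 (F b) (L b))))
  a
  where
  at-0 : ∀ f l → + 2 * f ≡ + 0 * l + + 2 * f
  at-0 = solve-∀
  at-1 : ∀ f l → f + l ≡ + 1 * l + + 1 * f
  at-1 = solve-∀

L-add : ∀ a b → + 2 * L (a + b) ≡ L a * L b + + 5 * F a * F b
L-add a b = FibRecurrence-unique
  (FibRecurrence-scaleˡ (FibRecurrence-shift L-rec b) (+ 2))
  (FibRecurrence-+ (FibRecurrence-scaleʳ L-rec (L b))
                   (FibRecurrence-scaleʳ (FibRecurrence-scaleˡ F-rec (+ 5)) (F b)))
  (trans (cong (λ i → + 2 * L i) (ℤP.+-identityˡ b)) (at-0 (L b) (F b)))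
  (trans (cong (λ i → + 2 * L i) (ℤP.+-comm (+ 1) b)) (trans (L-suc b) (at-1 (L b) (F b))))
  a
  where
  at-0 : ∀ l f → + 2 * l ≡ + 2 * l + + 5 * + 0 * f
  at-0 = solve-∀
  at-1 : ∀ l f → l + + 5 * f ≡ + 1 * l + + 5 * + 1 * f
  at-1 = solve-∀

F-neg : ∀ a → F (- a) ≡ - (neg1^ a * F a)
F-neg (+ zero) = refl
F-neg (+ suc k) =
  sym (trans (cong -_ (sym (ℤP.neg-distribˡ-* (sgnℕ k) (+ fibℕ (suc k)))))
             (ℤP.neg-involutive (sgnℕ k * + fibℕ (suc k))))
F-neg -[1+ k ] = sym (begin
  - (- s * (s * x))   ≡⟨ cong -_ (ℤP.neg-distribˡ-* s (s * x)) ⟨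
  - - (s * (s * x))   ≡⟨ ℤP.neg-involutive (s * (s * x)) ⟩
  s * (s * x)         ≡⟨ neg1^-cancel (+ k) x ⟩
  x                   ∎)
  where
  s x : ℤ
  s = sgnℕ k
  x = + fibℕ (suc k)

L-neg : ∀ a → L (- a) ≡ neg1^ a * L a
L-neg (+ zero) = refl
L-neg (+ suc k) = refl
L-neg -[1+ k ] = sym (neg1^-cancel (+ suc k) (+ lucℕ (suc k)))

F-sub : ∀ a b → + 2 * F (a - b) ≡ neg1^ b * (F a * L b - L a * F b)
F-sub a b = begin
  + 2 * F (a - b)                                  ≡⟨ F-add a (- b) ⟩
  F a * L (- b) + L a * F (- b)                    ≡⟨ cong₂ (λ u v → F a * u + L a * v) (L-neg b) (F-neg b) ⟩
  F a * (e * L b) + L a * - (e * F b)              ≡⟨ factor (F a) (L a) e (L b) (F b) ⟩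
  e * (F a * L b - L a * F b)                      ∎
  where
  e : ℤ
  e = neg1^ b
  factor : ∀ x y e u v → x * (e * u) + y * - (e * v) ≡ e * (x * u - y * v)
  factor = solve-∀

L-sub : ∀ a b → + 2 * L (a - b) ≡ neg1^ b * (L a * L b - + 5 * F a * F b)
L-sub a b = begin
  + 2 * L (a - b)                                  ≡⟨ L-add a (- b) ⟩
  L a * L (- b) + + 5 * F a * F (- b)              ≡⟨ cong₂ (λ u v → L a * u + + 5 * F a * v) (L-neg b) (F-neg b) ⟩
  L a * (e * L b) + + 5 * F a * - (e * F b)        ≡⟨ factor (L a) (F a) e (L b) (F b) ⟩
  e * (L a * L b - + 5 * F a * F b)                ∎
  where
  e : ℤ
  e = neg1^ b
  factor : ∀ x y e u v → x * (e * u) + + 5 * y * - (e * v) ≡ e * (x * u - + 5 * y * v)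
  factor = solve-∀

L²-5F² : ∀ a → L a * L a - + 5 * F a * F a ≡ + 4 * neg1^ a
L²-5F² a = begin
  D                     ≡⟨ neg1^-cancel a D ⟨
  e * (e * D)           ≡⟨ cong (e *_) (trans (sym (L-sub a a)) (cong (λ i → + 2 * L i) (ℤP.+-inverseʳ a))) ⟩
  e * + 4               ≡⟨ ℤP.*-comm e (+ 4) ⟩
  + 4 * e               ∎
  where
  e D : ℤ
  e = neg1^ a
  D = L a * L a - + 5 * F a * F a

F-add+sub : ∀ a b → F (a + b) + neg1^ b * F (a - b) ≡ F a * L b
F-add+sub a b = ℤP.*-cancelˡ-≡ (+ 2) _ _ (begin
  + 2 * (F (a + b) + e * F (a - b))            ≡⟨ distrib (F (a + b)) e (F (a - b)) ⟩
  + 2 * F (a + b) + e * (+ 2 * F (a - b))      ≡⟨ cong₂ (λ u v → u + e * v) (F-add a b) (F-sub a b) ⟩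
  (x + y) + e * (e * (x - y))                  ≡⟨ cong (λ w → (x + y) + w) (neg1^-cancel b (x - y)) ⟩
  (x + y) + (x - y)                            ≡⟨ double x y ⟩
  + 2 * x                                      ∎)
  where
  e x y : ℤ
  e = neg1^ b
  x = F a * L b
  y = L a * F b
  distrib : ∀ A e A′ → + 2 * (A + e * A′) ≡ + 2 * A + e * (+ 2 * A′)
  distrib = solve-∀
  double : ∀ x y → (x + y) + (x - y) ≡ + 2 * x
  double = solve-∀

FL-add+sub : ∀ a b → F (a + b) * L (a + b) + F (a - b) * L (a - b) ≡ F a * L a * L (+ 2 * b)
FL-add+sub a b = ℤP.*-cancelˡ-≡ (+ 4) _ _ (begin
  + 4 * (F (a + b) * L (a + b) + F (a - b) * L (a - b))
    ≡⟨ distrib (F (a + b)) (L (a + b)) (F (a - b)) (L (a - b)) ⟩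
  + 2 * F (a + b) * (+ 2 * L (a + b)) + + 2 * F (a - b) * (+ 2 * L (a - b))
    ≡⟨ cong₂ _+_ (cong₂ _*_ (F-add a b) (L-add a b)) (cong₂ _*_ (F-sub a b) (L-sub a b)) ⟩
  (x + y) * (u + v) + e * (x - y) * (e * (u - v))
    ≡⟨ cong (λ w → (x + y) * (u + v) + w) (signs e (x - y) (u - v)) ⟩
  (x + y) * (u + v) + e * (e * ((x - y) * (u - v)))
    ≡⟨ cong (λ w → (x + y) * (u + v) + w) (neg1^-cancel b ((x - y) * (u - v))) ⟩
  (x + y) * (u + v) + (x - y) * (u - v)
    ≡⟨ expand (F a) (L a) (F b) (L b) ⟩
  + 2 * F a * L a * (L b * L b + + 5 * F b * F b)
    ≡⟨ cong (+ 2 * F a * L a *_) (trans (sym (L-add b b)) (cong (λ i → + 2 * L i) (double-index b))) ⟩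
  + 2 * F a * L a * (+ 2 * L (+ 2 * b))
    ≡⟨ collect (F a) (L a) (L (+ 2 * b)) ⟩
  + 4 * (F a * L a * L (+ 2 * b)) ∎)
  where
  e x y u v : ℤ
  e = neg1^ b
  x = F a * L b
  y = L a * F b
  u = L a * L b
  v = + 5 * F a * F b
  distrib : ∀ A B A′ B′ → + 4 * (A * B + A′ * B′) ≡ + 2 * A * (+ 2 * B) + + 2 * A′ * (+ 2 * B′)
  distrib = solve-∀
  signs : ∀ e X Y → e * X * (e * Y) ≡ e * (e * (X * Y))
  signs = solve-∀
  expand : ∀ f l f′ l′ → (f * l′ + l * f′) * (l * l′ + + 5 * f * f′) + (f * l′ - l * f′) * (l * l′ - + 5 * f * f′)
                       ≡ + 2 * f * l * (l′ * l′ + + 5 * f′ * f′)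
  expand = solve-∀
  double-index : ∀ b → b + b ≡ + 2 * b
  double-index = solve-∀
  collect : ∀ f l c → + 2 * f * l * (+ 2 * c) ≡ + 4 * (f * l * c)
  collect = solve-∀

Sum-difference : ∀ a n → Sum a n - Sum a (n - + 1) ≡ a n
Sum-difference a (+ zero) = trans (ℤP.+-identityˡ (- - a (+ 0))) (ℤP.neg-involutive (a (+ 0)))
Sum-difference a (+ suc k) = cancel (sumFrom1 a k) (a (+ suc k))
  where
  cancel : ∀ S x → S + x - S ≡ x
  cancel = solve-∀
Sum-difference a -[1+ k ] = begin
  - sumNeg a k - Sum a (-[1+ k ] - + 1)   ≡⟨ cong (λ j → - sumNeg a k - Sum a j) (ℤP.neg-minus-pos k 1) ⟩
  - sumNeg a k - - (sumNeg a k + a -[1+ k ]) ≡⟨ cancel (sumNeg a k) (a -[1+ k ]) ⟩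
  a -[1+ k ]                               ∎
  where
  cancel : ∀ S x → - S - - (S + x) ≡ x
  cancel = solve-∀

telescope : ∀ (X Y : ℤ → ℤ) → X (+ 0) ≡ Y (+ 0) →
            (∀ n → X n - X (n - + 1) ≡ Y n - Y (n - + 1)) → ∀ n → X n ≡ Y n
telescope X Y eq₀ Δ-eq = ℤ-induction (λ n → X n ≡ Y n) eq₀ up down
  where
  pred-suc : ∀ z → z + + 1 - + 1 ≡ z
  pred-suc = solve-∀
  m-n+n≡m : ∀ m n → m - n + n ≡ m
  m-n+n≡m = solve-∀
  m-[m-n]≡n : ∀ m n → m - (m - n) ≡ n
  m-[m-n]≡n = solve-∀
  Δ-eq′ : ∀ z → X (z + + 1) - X z ≡ Y (z + + 1) - Y z
  Δ-eq′ z = subst (λ w → X (z + + 1) - X w ≡ Y (z + + 1) - Y w) (pred-suc z) (Δ-eq (z + + 1))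
  up : ∀ z → X z ≡ Y z → X (z + + 1) ≡ Y (z + + 1)
  up z eq = trans (sym (m-n+n≡m (X (z + + 1)) (X z)))
           (trans (cong₂ _+_ (Δ-eq′ z) eq) (m-n+n≡m (Y (z + + 1)) (Y z)))
  down : ∀ z → X (z + + 1) ≡ Y (z + + 1) → X z ≡ Y z
  down z eq = trans (sym (m-[m-n]≡n (X (z + + 1)) (X z)))
             (trans (cong₂ _-_ eq (Δ-eq′ z)) (m-[m-n]≡n (Y (z + + 1)) (Y z)))

closedForm : (m k k′ u t : ℤ) → ℤ
closedForm m k k′ u t = F k * F k′ * (u * L m * L k * L k′ + t * + 4 * L (+ 2 * m))

difference-identity : ∀ p q l C A B A′ B′ s σ e →
  A + e * A′ ≡ p * l → A * B + A′ * B′ ≡ p * q * C → q * q - + 5 * p * p ≡ + 4 * σ →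
  p * A * (- s * l * q * B + σ * s * + 4 * C) - A′ * p * (s * l * B′ * q + - (σ * s * e) * + 4 * C)
    ≡ + 5 * l * C * (- s * p ^ 4)
difference-identity p q l C A B A′ B′ s σ e sum product cassini = begin
  p * A * (- s * l * q * B + σ * s * + 4 * C) - A′ * p * (s * l * B′ * q + - (σ * s * e) * + 4 * C)
    ≡⟨ solve (p ∷ q ∷ l ∷ C ∷ A ∷ B ∷ A′ ∷ B′ ∷ s ∷ σ ∷ e ∷ []) ⟩
  s * p * (+ 4 * σ * C * (A + e * A′) - l * q * (A * B + A′ * B′))
    ≡⟨ cong₂ (λ X Y → s * p * (+ 4 * σ * C * X - l * q * Y)) sum product ⟩
  s * p * (+ 4 * σ * C * (p * l) - l * q * (p * q * C))
    ≡⟨ solve (p ∷ q ∷ l ∷ C ∷ s ∷ σ ∷ []) ⟩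
  s * p * p * l * C * (+ 4 * σ - q * q)
    ≡⟨ cong (λ X → s * p * p * l * C * (X - q * q)) cassini ⟨
  s * p * p * l * C * (q * q - + 5 * p * p - q * q)
    ≡⟨ solve (p ∷ q ∷ l ∷ C ∷ s ∷ []) ⟩
  + 5 * l * C * (- s * (p * (p * (p * (p * + 1)))))
    ≡⟨⟩
  + 5 * l * C * (- s * p ^ 4) ∎

closedForm-difference : ∀ m N s →
  closedForm m N (N + m) (- s) (neg1^ N * s) - closedForm m (N - m) N s (- (neg1^ N * s * neg1^ m))
    ≡ + 5 * L m * L (+ 2 * m) * (- s * F N ^ 4)
closedForm-difference m N s =
  difference-identity (F N) (L N) (L m) (L (+ 2 * m)) (F (N + m)) (L (N + m)) (F (N - m)) (L (N - m))
                      s (neg1^ N) (neg1^ m) (F-add+sub N m) (FL-add+sub N m) (L²-5F² N)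

rhs : ℤ → ℤ → ℤ
rhs m n = closedForm m (m * n) (m * n + m) (neg1^ (n - + 1)) (neg1^ (n * (m - + 1)))

rhs-zero : ∀ m → rhs m (+ 0) ≡ + 0
rhs-zero m = cong (λ k → closedForm m k (m * + 0 + m) (neg1^ (+ 0 - + 1)) (neg1^ (+ 0 * (m - + 1))))
                  (ℤP.*-zeroʳ m)

rhs-difference : ∀ m n →
  rhs m n - rhs m (n - + 1) ≡ + 5 * L m * L (+ 2 * m) * (neg1^ (n - + 1) * F (m * n) ^ 4)
rhs-difference m n = begin
  rhs m n - rhs m (n - + 1)
    ≡⟨ cong₂ _-_ (cong₂ (closedForm m N (N + m)) (neg1^-pred n) sign) previous ⟩
  closedForm m N (N + m) (- s) (σ * s) - closedForm m (N - m) N s (- (σ * s * e))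
    ≡⟨ closedForm-difference m N s ⟩
  + 5 * L m * L (+ 2 * m) * (- s * F N ^ 4)
    ≡⟨ cong (λ u → + 5 * L m * L (+ 2 * m) * (u * F N ^ 4)) (neg1^-pred n) ⟨
  + 5 * L m * L (+ 2 * m) * (neg1^ (n - + 1) * F N ^ 4) ∎
  where
  N s σ e : ℤ
  N = m * n
  s = neg1^ n
  σ = neg1^ N
  e = neg1^ m
  exponent : ∀ m n → n * (m - + 1) ≡ m * n - n
  exponent = solve-∀
  exponent′ : ∀ m n → (n - + 1) * (m - + 1) ≡ m * n - n - m + + 1
  exponent′ = solve-∀
  index : ∀ m n → m * (n - + 1) ≡ m * n - m
  index = solve-∀
  index′ : ∀ m n → m * (n - + 1) + m ≡ m * n
  index′ = solve-∀
  sign : neg1^ (n * (m - + 1)) ≡ σ * s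
  sign = trans (cong neg1^ (exponent m n)) (neg1^-sub N n)
  sign-pred : neg1^ (n - + 1 - + 1) ≡ s
  sign-pred = trans (neg1^-pred (n - + 1)) (trans (cong -_ (neg1^-pred n)) (ℤP.neg-involutive s))
  sign-pred′ : neg1^ ((n - + 1) * (m - + 1)) ≡ - (σ * s * e)
  sign-pred′ = begin
    neg1^ ((n - + 1) * (m - + 1)) ≡⟨ cong neg1^ (exponent′ m n) ⟩
    neg1^ (N - n - m + + 1)       ≡⟨ neg1^-suc (N - n - m) ⟩
    - neg1^ (N - n - m)           ≡⟨ cong -_ (trans (neg1^-sub (N - n) m) (cong (_* e) (neg1^-sub N n))) ⟩
    - (σ * s * e)                 ∎
  previous : rhs m (n - + 1) ≡ closedForm m (N - m) N s (- (σ * s * e))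
  previous = trans (cong₂ (λ k k′ → closedForm m k k′ (neg1^ (n - + 1 - + 1)) (neg1^ ((n - + 1) * (m - + 1))))
                          (index m n) (index′ m n))
                   (cong₂ (closedForm m (N - m) N) sign-pred sign-pred′)

mainTheorem3 : (m n : ℤ) →
    + 5 * L m * L (+ 2 * m) * Sum (λ k → neg1^ (k - + 1) * F (m * k) ^ 4) n
      ≡ F (m * n) * F (m * n + m)
        * (neg1^ (n - + 1) * L m * L (m * n) * L (m * n + m)
           + neg1^ (n * (m - + 1)) * + 4 * L (+ 2 * m))
mainTheorem3 m = telescope (λ n → c * Sum a n) (rhs m) base difference
  where
  a : ℤ → ℤ
  a k = neg1^ (k - + 1) * F (m * k) ^ 4
  c : ℤ
  c = + 5 * L m * L (+ 2 * m)
  base : c * + 0 ≡ rhs m (+ 0)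
  base = trans (ℤP.*-zeroʳ c) (sym (rhs-zero m))
  difference : ∀ n → c * Sum a n - c * Sum a (n - + 1) ≡ rhs m n - rhs m (n - + 1)
  difference n = begin
    c * Sum a n - c * Sum a (n - + 1) ≡⟨ x[y-z]≈xy-xz c (Sum a n) (Sum a (n - + 1)) ⟨
    c * (Sum a n - Sum a (n - + 1))   ≡⟨ cong (c *_) (Sum-difference a n) ⟩
    c * a n                           ≡⟨ rhs-difference m n ⟨
    rhs m n - rhs m (n - + 1)         ∎
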